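{- Let $G$ be a finite graph, $v\in V(G)$, and $u$ a neighbor of $v$. If the edge $f=\{u,v\}$ is revealed by $v$, then $\mathcal{O}_{\{u,v\}}=\mathcal{O}_v$.
   Context: All graphs are finite, simple and undirected. A walk is a sequence of vertices $v_0,\ldots,v_k$ with consecutive vertices adjacent; it is non-backtracking if $v_i\neq v_{i+2}$ for all $0\le i\le k-2$, and closed at $x$ if $v_0=v_k=x$ (first and last edges of a closed walk may coincide). For a weight function $F:E(G)\to\mathbb{R}$ write $w_e=F(e)$ and $F(W)=\sum_{i=0}^{k-1}F(\{v_i,v_{i+1}\})$ (with multiplicity). $\mathcal{W}_x$ is the set of closed non-backtracking walks at $x$, and for $S\subseteq V(G)$, $\mathcal{W}_S=\bigcup_{x\in S}\mathcal{W}_x$ (walks may have different base points in $S$). An edge $e$ is revealed by $S$ if there exist $W_1,\ldots,W_\ell\in\mathcal{W}_S$ and nonzero integers $c_e,c_1,\ldots,c_\ell$ with $\sum_i c_iF(W_i)=c_ew_e$ for every weight function $F$. $\mathcal{O}_S$ is the set of edges revealed by $S$; for a single vertex, $\mathcal{O}_v=\mathcal{O}_{\{v\}}$ and "revealed by $v$" means revealed by $\{v\}$. -}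

module Defs where

open import Data.Nat using (ℕ)
open import Data.Fin using (Fin)
open import Data.Bool using (Bool; true; false)
open import Data.Integer using (ℤ; _+_; _*_) renaming (0ℤ to 0ℤ)
open import Data.List using (List; []; _∷_)
open import Data.List.Relation.Unary.All using (All)
open import Data.Product using (Σ; _×_; _,_; ∃)
open import Data.Sum using (_⊎_)
open import Data.Unit using (⊤)
open import Data.Empty using (⊥)
open import Relation.Nullary using (¬_)
open import Relation.Binary.PropositionalEquality using (_≡_; _≢_)
open import Function.Bundles using (_⇔_)

record Graph (n : ℕ) : Set where
  field
    adj    : Fin n → Fin n → Bool
    sym    : ∀ x y → adj x y ≡ adj y x
    irrefl : ∀ x → adj x x ≡ false

module _ {n : ℕ} (G : Graph n) where
  open Graph G

  Adj : Fin n → Fin n → Set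
  Adj x y = adj x y ≡ true

  IsWalk : List (Fin n) → Set
  IsWalk []            = ⊥
  IsWalk (x ∷ [])      = ⊤
  IsWalk (x ∷ y ∷ r)   = Adj x y × IsWalk (y ∷ r)

NonBacktracking : {n : ℕ} → List (Fin n) → Set
NonBacktracking (x ∷ y ∷ z ∷ r) = (x ≢ z) × NonBacktracking (y ∷ z ∷ r)
NonBacktracking _               = ⊤

lastOf : {n : ℕ} → Fin n → List (Fin n) → Fin n
lastOf x []      = x
lastOf x (y ∷ r) = lastOf y r

ClosedAt : {n : ℕ} → Fin n → List (Fin n) → Set
ClosedAt x []      = ⊥
ClosedAt x (y ∷ r) = (y ≡ x) × (lastOf y r ≡ x)

InW : {n : ℕ} → Graph n → Fin n → List (Fin n) → Set
InW G x w = IsWalk G w × NonBacktracking w × ClosedAt x w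

InWS : {n : ℕ} → Graph n → (Fin n → Set) → List (Fin n) → Set
InWS G S w = Σ _ λ x → S x × InW G x w

-- A weight function: F(x,y) is the weight of edge {x,y}; symmetric so that it is
-- a function of the unordered edge (values on non-edges are never used).
SymmetricW : {n : ℕ} → (Fin n → Fin n → ℤ) → Set
SymmetricW F = ∀ x y → F x y ≡ F y x

weight : {n : ℕ} → (Fin n → Fin n → ℤ) → List (Fin n) → ℤ
weight F (x ∷ y ∷ r) = F x y + weight F (y ∷ r)
weight F _           = 0ℤ

lincomb : {n : ℕ} → (Fin n → Fin n → ℤ) → List (ℤ × List (Fin n)) → ℤ
lincomb F []             = 0ℤ
lincomb F ((c , w) ∷ cs) = c * weight F w + lincomb F cs

Revealed : {n : ℕ} → Graph n → (Fin n → Set) → Fin n → Fin n → Set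
Revealed {n} G S a b =
  Σ (List (ℤ × List (Fin n))) λ cws →
    All (λ cw → (Data.Product.proj₁ cw ≢ 0ℤ) × InWS G S (Data.Product.proj₂ cw)) cws ×
    Σ ℤ λ ce → (ce ≢ 0ℤ) ×
      (∀ (F : Fin n → Fin n → ℤ) → SymmetricW F → lincomb F cws ≡ ce * F a b)

SameRevealed : {n : ℕ} → Graph n → (Fin n → Set) → (Fin n → Set) → Set
SameRevealed {n} G S T = ∀ (a b : Fin n) → Adj G a b → (Revealed G S a b ⇔ Revealed G T a b)

singleton : {n : ℕ} → Fin n → Fin n → Set
singleton v x = x ≡ v

pair : {n : ℕ} → Fin n → Fin n → Fin n → Set
pair u v x = (x ≡ u) ⊎ (x ≡ v)

module Submission where

-- Call an integer-valued functional f of weight functions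
-- *expressible* by S if f(F) = Σᵢ cᵢ F(Wᵢ) for nonzero cᵢ and walks Wᵢ ∈ 𝒲_S,
-- uniformly in the symmetric weight F.  Expressible functionals form a
-- ℤ-module, and an edge e is revealed by S iff c·w_e is expressible for some
-- c ≠ 0.  Since {v} ⊆ {u,v}, only 𝒪_{u,v} ⊆ 𝒪_v needs an argument.
--
-- Rerooting: every nontrivial closed non-backtracking walk W at u can be
-- turned into one at v by adjusting each end separately.  At the front, if W
-- starts u,v,… we drop the leading u, otherwise we prepend v; at the back we
-- symmetrically drop the trailing u or append v.  Each step keeps the walk
-- non-backtracking and changes F(W) by ±w_{uv}.  So F(W) = F(W') + k·w_{uv}
-- with W' ∈ 𝒲_v.  If c·w_{uv} is expressible by v, then c·F(W) is too, and by
-- linearity c·Σᵢ cᵢF(Wᵢ) is expressible by v for any combination of walks in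
-- 𝒲_{u,v}; this turns a revelation of an edge by {u,v} into one by v.

open import Defs
open import Data.Nat using (ℕ)
open import Data.Fin using (Fin)
open import Data.Fin.Properties using (_≟_)
open import Data.Integer using (ℤ; _+_; _*_; 0ℤ; 1ℤ; -1ℤ)
import Data.Integer as ℤ
import Data.Integer.Properties as ℤP
open import Data.Integer.Tactic.RingSolver using (solve-∀)
open import Data.List using (List; []; _∷_; _∷ʳ_; _++_; map)
open import Data.List.Reverse using (reverseView; []; _∶_∶ʳ_)
open import Data.List.Relation.Unary.All using (All; []; _∷_)
import Data.List.Relation.Unary.All as All
open import Data.List.Relation.Unary.All.Properties using (++⁺)
open import Data.Product using (Σ; _×_; _,_; proj₁; proj₂)
open import Data.Sum using (_⊎_; inj₁; inj₂)
open import Data.Unit using (⊤; tt)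
open import Data.Empty using (⊥-elim)
open import Relation.Nullary using (yes; no)
open import Relation.Binary.PropositionalEquality
open import Function.Bundles using (mk⇔)

lastOf-snoc : ∀ {n} (x : Fin n) xs y → lastOf x (xs ∷ʳ y) ≡ y
lastOf-snoc x []       y = refl
lastOf-snoc x (z ∷ zs) y = lastOf-snoc z zs y

weight-snoc : ∀ {n} (F : Fin n → Fin n → ℤ) x xs y →
  weight F (x ∷ xs ∷ʳ y) ≡ weight F (x ∷ xs) + F (lastOf x xs) y
weight-snoc F x []       y = ℤP.+-comm (F x y) 0ℤ
weight-snoc F x (z ∷ zs) y = begin
  F x z + weight F (z ∷ zs ∷ʳ y)                  ≡⟨ cong (F x z +_) (weight-snoc F z zs y) ⟩
  F x z + (weight F (z ∷ zs) + F (lastOf z zs) y) ≡⟨ ℤP.+-assoc (F x z) _ _ ⟨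
  F x z + weight F (z ∷ zs) + F (lastOf z zs) y   ∎
  where open ≡-Reasoning

-- NoBacktrackInto x xs y: the penultimate vertex of x ∷ xs is not y, i.e.
-- appending y to x ∷ xs creates no backtrack.
NoBacktrackInto : ∀ {n} → Fin n → List (Fin n) → Fin n → Set
NoBacktrackInto x []            y = ⊤
NoBacktrackInto x (z ∷ [])      y = x ≢ y
NoBacktrackInto x (z ∷ z' ∷ zs) y = NoBacktrackInto z (z' ∷ zs) y

nb-snoc : ∀ {n} (x : Fin n) xs y → NonBacktracking (x ∷ xs) →
  NoBacktrackInto x xs y → NonBacktracking (x ∷ xs ∷ʳ y)
nb-snoc x []            y _       _ = tt
nb-snoc x (z ∷ [])      y _       p = p , tt
nb-snoc x (z ∷ z' ∷ zs) y (p , q) r = p , nb-snoc z (z' ∷ zs) y q r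

noBacktrackInto-snoc : ∀ {n} (x : Fin n) xs y z →
  lastOf x xs ≢ z → NoBacktrackInto x (xs ∷ʳ y) z
noBacktrackInto-snoc x []            y z p = p
noBacktrackInto-snoc x (w ∷ [])      y z p = p
noBacktrackInto-snoc x (w ∷ w' ∷ ws) y z p = noBacktrackInto-snoc w (w' ∷ ws) y z p

nb-prefix : ∀ {n} (xs ys : List (Fin n)) →
  NonBacktracking (xs ++ ys) → NonBacktracking xs
nb-prefix (x ∷ y ∷ z ∷ r) ys (p , q) = p , nb-prefix (y ∷ z ∷ r) ys q
nb-prefix []              ys _       = tt
nb-prefix (x ∷ [])        ys _       = tt
nb-prefix (x ∷ y ∷ [])    ys _       = tt

nb-tail : ∀ {n} (x : Fin n) ys → NonBacktracking (x ∷ ys) → NonBacktracking ys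
nb-tail x []            _       = tt
nb-tail x (a ∷ [])      _       = tt
nb-tail x (a ∷ b ∷ r)   (_ , q) = q

module _ {n : ℕ} (G : Graph n) where

  walk-prefix : ∀ x xs ys → IsWalk G (x ∷ xs ++ ys) → IsWalk G (x ∷ xs)
  walk-prefix x []       ys _       = tt
  walk-prefix x (y ∷ xs) ys (a , w) = a , walk-prefix y xs ys w

  walk-snoc : ∀ x xs y → IsWalk G (x ∷ xs) → Adj G (lastOf x xs) y →
    IsWalk G (x ∷ xs ∷ʳ y)
  walk-snoc x []       y _       a = a , tt
  walk-snoc x (z ∷ zs) y (a , w) b = a , walk-snoc z zs y w b

nz* : ∀ {i j : ℤ} → i ≢ 0ℤ → j ≢ 0ℤ → i * j ≢ 0ℤ
nz* {i} i≢0 j≢0 ij≡0 with ℤP.i*j≡0⇒i≡0∨j≡0 i ij≡0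
... | inj₁ i≡0 = i≢0 i≡0
... | inj₂ j≡0 = j≢0 j≡0

Weights : ℕ → Set
Weights n = Fin n → Fin n → ℤ

module Expressibility {n : ℕ} (G : Graph n) where

  Term : (Fin n → Set) → ℤ × List (Fin n) → Set
  Term S cw = (proj₁ cw ≢ 0ℤ) × InWS G S (proj₂ cw)

  Expressible : (Fin n → Set) → (Weights n → ℤ) → Set
  Expressible S f = Σ (List (ℤ × List (Fin n))) λ L → All (Term S) L ×
    (∀ F → SymmetricW F → lincomb F L ≡ f F)

  expr-cong : ∀ {S f g} → (∀ F → SymmetricW F → f F ≡ g F) →
    Expressible S f → Expressible S g
  expr-cong f≡g (L , terms , eq) = L , terms , λ F s → trans (eq F s) (f≡g F s)

  expr-mono : ∀ {S T f} → (∀ x → S x → T x) → Expressible S f → Expressible T f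
  expr-mono S⊆T (L , terms , eq) =
    L , All.map (λ { (c≢0 , x , x∈S , w) → c≢0 , x , S⊆T x x∈S , w }) terms , eq

  expr-zero : ∀ {S} → Expressible S (λ _ → 0ℤ)
  expr-zero = [] , [] , λ _ _ → refl

  expr-walk : ∀ {S w} → InWS G S w → Expressible S (λ F → weight F w)
  expr-walk {w = w} w∈S =
    (1ℤ , w) ∷ [] , ((λ ()) , w∈S) ∷ [] , λ F _ → one-term (weight F w)
    where
      one-term : ∀ a → 1ℤ * a + 0ℤ ≡ a
      one-term = solve-∀

  lincomb-++ : ∀ F (xs ys : List (ℤ × List (Fin n))) →
    lincomb F (xs ++ ys) ≡ lincomb F xs + lincomb F ys
  lincomb-++ F []             ys = sym (ℤP.+-identityˡ _)
  lincomb-++ F ((c , w) ∷ xs) ys = trans (cong (c * weight F w +_) (lincomb-++ F xs ys))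
    (sym (ℤP.+-assoc (c * weight F w) (lincomb F xs) (lincomb F ys)))

  expr-+ : ∀ {S f g} → Expressible S f → Expressible S g →
    Expressible S (λ F → f F + g F)
  expr-+ (L , tL , eL) (M , tM , eM) =
    L ++ M , ++⁺ tL tM , λ F s → trans (lincomb-++ F L M) (cong₂ _+_ (eL F s) (eM F s))

  scale : ℤ → List (ℤ × List (Fin n)) → List (ℤ × List (Fin n))
  scale k = map (λ cw → k * proj₁ cw , proj₂ cw)

  lincomb-scale : ∀ F k L → lincomb F (scale k L) ≡ k * lincomb F L
  lincomb-scale F k []            = sym (ℤP.*-zeroʳ k)
  lincomb-scale F k ((c , w) ∷ L) =
    trans (cong ((k * c) * weight F w +_) (lincomb-scale F k L))
          (distribute k c (weight F w) (lincomb F L))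
    where
      distribute : ∀ k c a l → (k * c) * a + k * l ≡ k * (c * a + l)
      distribute = solve-∀

  terms-scale : ∀ {S} k → k ≢ 0ℤ → ∀ L → All (Term S) L → All (Term S) (scale k L)
  terms-scale k k≢0 []      []                   = []
  terms-scale k k≢0 (_ ∷ L) ((c≢0 , w) ∷ terms) = (nz* k≢0 c≢0 , w) ∷ terms-scale k k≢0 L terms

  expr-scale : ∀ {S f} k → Expressible S f → Expressible S (λ F → k * f F)
  expr-scale {f = f} k (L , terms , eq) with k ℤ.≟ 0ℤ
  ... | yes refl = expr-cong (λ F _ → sym (ℤP.*-zeroˡ (f F))) expr-zero
  ... | no k≢0   = scale k L , terms-scale k k≢0 L terms ,
                   λ F s → trans (lincomb-scale F k L) (cong (k *_) (eq F s))

  expr-lincomb : ∀ {S T} c → (∀ w → InWS G T w → Expressible S (λ F → c * weight F w)) →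
    ∀ L → All (Term T) L → Expressible S (λ F → c * lincomb F L)
  expr-lincomb c walks []            []                  =
    expr-cong (λ F _ → sym (ℤP.*-zeroʳ c)) expr-zero
  expr-lincomb c walks ((d , w) ∷ L) ((_ , w∈T) ∷ terms) =
    expr-cong (λ F _ → regroup c d (weight F w) (lincomb F L))
      (expr-+ (expr-scale d (walks w w∈T)) (expr-lincomb c walks L terms))
    where
      regroup : ∀ c d a l → d * (c * a) + c * l ≡ c * (d * a + l)
      regroup = solve-∀

module Rerooting {n : ℕ} (G : Graph n) (u v : Fin n) (vu : Adj G v u) where

  uv : Adj G u v
  uv = trans (Graph.sym G u v) vu

  u≢v : u ≢ v
  u≢v refl with trans (sym vu) (Graph.irrefl G u)
  ... | ()

  NBWalk : Fin n → List (Fin n) → Fin n → Set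
  NBWalk x r y = IsWalk G (x ∷ r) × NonBacktracking (x ∷ r) × lastOf x r ≡ y

  record _≈_ (W W' : List (Fin n)) : Set where
    constructor shifted-by
    field
      multiple : ℤ
      shift    : ∀ F → SymmetricW F → weight F W ≡ weight F W' + multiple * F u v

  ≈-trans : ∀ {W₁ W₂ W₃} → W₁ ≈ W₂ → W₂ ≈ W₃ → W₁ ≈ W₃
  ≈-trans {W₃ = W₃} (shifted-by k e) (shifted-by k' e') = shifted-by (k + k') λ F s →
    trans (e F s) (trans (cong (_+ k * F u v) (e' F s)) (add-multiples (weight F W₃) k k' (F u v)))
    where
      add-multiples : ∀ a k k' x → (a + k' * x) + k * x ≡ a + (k + k') * x
      add-multiples = solve-∀

  reroot-front : ∀ a r y → NBWalk u (a ∷ r) y →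
    Σ (List (Fin n)) λ r' → NBWalk v r' y × (u ∷ a ∷ r) ≈ (v ∷ r')
  reroot-front a r y (walk , nb , end) with a ≟ v
  ... | yes refl = r , (proj₂ walk , nb-tail u (v ∷ r) nb , end) ,
                   shifted-by 1ℤ λ F _ → drop-cost (F u v) (weight F (v ∷ r))
    where
      drop-cost : ∀ x a → x + a ≡ a + 1ℤ * x
      drop-cost = solve-∀
  ... | no a≢v   = u ∷ a ∷ r , ((vu , walk) , ((λ v≡a → a≢v (sym v≡a)) , nb) , end) ,
                   shifted-by -1ℤ λ F s → trans (prepend-cost (F u v) (weight F (u ∷ a ∷ r)))
                                       (cong (λ x → x + weight F (u ∷ a ∷ r) + -1ℤ * F u v) (s u v))
    where
      prepend-cost : ∀ x a → a ≡ x + a + -1ℤ * x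
      prepend-cost = solve-∀

  reroot-back : ∀ x m → IsWalk G (x ∷ m ∷ʳ u) → NonBacktracking (x ∷ m ∷ʳ u) →
    Σ (List (Fin n)) λ r' → NBWalk x r' v × (x ∷ m ∷ʳ u) ≈ (x ∷ r')
  reroot-back x m walk nb with lastOf x m ≟ v
  ... | yes last≡v =
    m , (walk-prefix G x m (u ∷ []) walk , nb-prefix (x ∷ m) (u ∷ []) nb , last≡v) ,
    shifted-by 1ℤ λ F s → begin
      weight F (x ∷ m ∷ʳ u)             ≡⟨ weight-snoc F x m u ⟩
      weight F (x ∷ m) + F (lastOf x m) u ≡⟨ cong (λ y → weight F (x ∷ m) + F y u) last≡v ⟩
      weight F (x ∷ m) + F v u           ≡⟨ cong (weight F (x ∷ m) +_) (s v u) ⟩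
      weight F (x ∷ m) + F u v           ≡⟨ cong (weight F (x ∷ m) +_) (ℤP.*-identityˡ (F u v)) ⟨
      weight F (x ∷ m) + 1ℤ * F u v      ∎
    where open ≡-Reasoning
  ... | no last≢v =
    m ∷ʳ u ∷ʳ v ,
    (walk-snoc G x (m ∷ʳ u) v walk (subst (λ y → Adj G y v) (sym (lastOf-snoc x m u)) uv) ,
     nb-snoc x (m ∷ʳ u) v nb (noBacktrackInto-snoc x m u v last≢v) ,
     lastOf-snoc x (m ∷ʳ u) v) ,
    shifted-by -1ℤ λ F _ → begin
      weight F W                                      ≡⟨ append-cost (weight F W) (F u v) ⟩
      weight F W + F u v + -1ℤ * F u v                 ≡⟨ cong (λ y → weight F W + F y v + -1ℤ * F u v)
                                                              (lastOf-snoc x m u) ⟨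
      weight F W + F (lastOf x (m ∷ʳ u)) v + -1ℤ * F u v ≡⟨ cong (_+ -1ℤ * F u v)
                                                              (weight-snoc F x (m ∷ʳ u) v) ⟨
      weight F (W ∷ʳ v) + -1ℤ * F u v                  ∎
    where
      open ≡-Reasoning
      W = x ∷ m ∷ʳ u
      append-cost : ∀ a x → a ≡ a + x + -1ℤ * x
      append-cost = solve-∀

  reroot : ∀ W → InW G u W →
    (∀ F → weight F W ≡ 0ℤ) ⊎ Σ (List (Fin n)) λ W' → InW G v W' × W ≈ W'
  reroot (u ∷ [])    (_ , _ , refl , _)       = inj₁ λ F → refl
  reroot (u ∷ a ∷ r) (walk , nb , refl , end) with reroot-front a r u (walk , nb , end)
  ... | r₁ , (walk₁ , nb₁ , end₁) , W≈W₁ with reverseView r₁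
  ...   | [] = ⊥-elim (u≢v (sym end₁))
  ...   | m ∶ _ ∶ʳ z with trans (sym (lastOf-snoc v m z)) end₁
  ...     | refl with reroot-back v m walk₁ nb₁
  ...       | r₂ , (walk₂ , nb₂ , end₂) , W₁≈W₂ =
    inj₂ (v ∷ r₂ , (walk₂ , nb₂ , refl , end₂) , ≈-trans W≈W₁ W₁≈W₂)

module FromPair {n : ℕ} (G : Graph n) (v u : Fin n) (vu : Adj G v u)
                (c : ℤ) (c-uv : Expressibility.Expressible G (singleton v) (λ F → c * F u v)) where
  open Expressibility G
  open Rerooting G u v vu

  expr-walk-pair : ∀ W → InWS G (pair u v) W → Expressible (singleton v) (λ F → c * weight F W)
  expr-walk-pair W (x , inj₂ refl , W∈v) = expr-scale c (expr-walk (x , refl , W∈v))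
  expr-walk-pair W (x , inj₁ refl , W∈u) with reroot W W∈u
  ... | inj₁ zero-weight =
    expr-cong (λ F _ → trans (sym (ℤP.*-zeroʳ c)) (cong (c *_) (sym (zero-weight F)))) expr-zero
  ... | inj₂ (W' , W'∈v , shifted-by k W≈W') =
    expr-cong (λ F s → trans (shift c (weight F W') k (F u v)) (cong (c *_) (sym (W≈W' F s))))
      (expr-+ (expr-scale c (expr-walk (v , refl , W'∈v))) (expr-scale k c-uv))
    where
      shift : ∀ c a k x → c * a + k * (c * x) ≡ c * (a + k * x)
      shift = solve-∀

lemma3p6 : (n : ℕ) (G : Graph n) (v u : Fin n) → Adj G v u →
    Revealed G (singleton v) u v → SameRevealed G (pair u v) (singleton v)
lemma3p6 n G v u vu (L , terms , c , c≢0 , eq) a b _ = mk⇔ toSingle fromSingle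
  where
    open Expressibility G
    open FromPair G v u vu c (L , terms , eq)

    toSingle : Revealed G (pair u v) a b → Revealed G (singleton v) a b
    toSingle (M , termsM , d , d≢0 , eqM) =
      let (L' , terms' , eq') = expr-lincomb c expr-walk-pair M termsM
      in L' , terms' , c * d , nz* c≢0 d≢0 ,
         λ F s → trans (eq' F s) (trans (cong (c *_) (eqM F s)) (sym (ℤP.*-assoc c d (F a b))))

    fromSingle : Revealed G (singleton v) a b → Revealed G (pair u v) a b
    fromSingle (M , termsM , d , d≢0 , eqM) =
      let (M' , termsM' , eqM') = expr-mono (λ _ → inj₂) (M , termsM , eqM)
      in M' , termsM' , d , d≢0 , eqM'
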